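{- Let $A,B\subset\mathbb{H}$ be finite sets with $|A|\geq 2$ and $|B|\geq 2$. Then there exists a line $\ell$ in $\mathbb{H}^2$ such that $2\leq|(A\times B)\cap\ell|\leq 5$.
   Context: $\mathbb{H}$ denotes the quaternions and $\mathbb{H}^2$ is regarded as a left vector space over $\mathbb{H}$. A line in $\mathbb{H}^2$ is a set of the form $\{p+\lambda v:\lambda\in\mathbb{H}\}$ with $p,v\in\mathbb{H}^2$, $v\neq 0$ (scalars multiplying on the left); equivalently, lines are the sets $\{(x,y): x=c\}$ for $c\in\mathbb{H}$, and $\{(x,y): y=xm+c\}$ for $m,c\in\mathbb{H}$. -}

module Defs where

open import Level using (Level; _⊔_) renaming (suc to lsuc)
open import Algebra.Bundles using (CommutativeRing)
open import Relation.Binary.Structures using (IsTotalOrder)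
open import Relation.Nullary using (¬_)
open import Data.Product using (Σ; ∃; _×_; _,_)
open import Data.List using (List; length)
open import Data.Nat using (ℕ)
import Data.Nat as ℕ
open import Relation.Binary.Bundles using (Setoid)
import Data.List.Relation.Unary.Unique.Setoid as UniqueS
import Data.List.Membership.Setoid as MemS
open import Data.List.Relation.Unary.All using (All)

-- The real numbers, given axiomatically as a complete ordered field
-- (categorical: any model is isomorphic to ℝ).
record RealField (c ℓ : Level) : Set (lsuc (c ⊔ ℓ)) where
  field
    commutativeRing : CommutativeRing c ℓ
  open CommutativeRing commutativeRing public
  field
    _≤_          : Carrier → Carrier → Set ℓ
    isTotalOrder : IsTotalOrder _≈_ _≤_
    0≉1          : ¬ (0# ≈ 1#)
    inverse      : ∀ x → ¬ (x ≈ 0#) → ∃ λ y → x * y ≈ 1#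
    +-monoˡ-≤    : ∀ {x y} z → x ≤ y → (x + z) ≤ (y + z)
    *-nonneg     : ∀ {x y} → 0# ≤ x → 0# ≤ y → 0# ≤ (x * y)
    lub : (P : Carrier → Set (c ⊔ ℓ)) → (∃ P) →
          (∃ λ u → ∀ x → P x → x ≤ u) →
          ∃ λ s → (∀ x → P x → x ≤ s) × (∀ u → (∀ x → P x → x ≤ u) → s ≤ u)

module Quaternions {c ℓ : Level} (R : RealField c ℓ) where
  open RealField R

  record ℍ : Set c where
    constructor quat
    field re ii jj kk : Carrier
  open ℍ public

  _≈ℍ_ : ℍ → ℍ → Set ℓ
  p ≈ℍ q = (re p ≈ re q) × (ii p ≈ ii q) × (jj p ≈ jj q) × (kk p ≈ kk q)

  0ℍ : ℍ
  0ℍ = quat 0# 0# 0# 0#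

  _+ℍ_ : ℍ → ℍ → ℍ
  quat a b c' d +ℍ quat a' b' c'' d' = quat (a + a') (b + b') (c' + c'') (d + d')

  _*ℍ_ : ℍ → ℍ → ℍ
  quat a₁ b₁ c₁ d₁ *ℍ quat a₂ b₂ c₂ d₂ = quat
    (a₁ * a₂ - b₁ * b₂ - c₁ * c₂ - d₁ * d₂)
    (a₁ * b₂ + b₁ * a₂ + c₁ * d₂ - d₁ * c₂)
    (a₁ * c₂ - b₁ * d₂ + c₁ * a₂ + d₁ * b₂)
    (a₁ * d₂ + b₁ * c₂ - c₁ * b₂ + d₁ * a₂)

  ℍ² : Set c
  ℍ² = ℍ × ℍ

  _≈²_ : ℍ² → ℍ² → Set ℓ
  (x , y) ≈² (x' , y') = (x ≈ℍ x') × (y ≈ℍ y')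

  open import Relation.Binary.Structures using (IsEquivalence)
  private
    module E = IsEquivalence isEquivalence
    isEqℍ : IsEquivalence _≈ℍ_
    isEqℍ = record
      { refl  = E.refl , E.refl , E.refl , E.refl
      ; sym   = λ { (a , b , c' , d) → E.sym a , E.sym b , E.sym c' , E.sym d }
      ; trans = λ { (a , b , c' , d) (a' , b' , c'' , d') →
                    E.trans a a' , E.trans b b' , E.trans c' c'' , E.trans d d' } }
    module Eℍ = IsEquivalence isEqℍ

  ℍ-setoid : Setoid c ℓ
  ℍ-setoid = record { Carrier = ℍ ; _≈_ = _≈ℍ_ ; isEquivalence = isEqℍ }

  ℍ²-setoid : Setoid c ℓ
  ℍ²-setoid = record
    { Carrier = ℍ² ; _≈_ = _≈²_
    ; isEquivalence = record
      { refl  = Eℍ.refl , Eℍ.refl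
      ; sym   = λ { (p , q) → Eℍ.sym p , Eℍ.sym q }
      ; trans = λ { (p , q) (p' , q') → Eℍ.trans p p' , Eℍ.trans q q' } } }

  -- finite subsets of ℍ: duplicate-free lists (|A| = length)
  UniqueℍList : List ℍ → Set (c ⊔ ℓ)
  UniqueℍList = UniqueS.Unique ℍ-setoid

  _∈ℍ_ : ℍ → List ℍ → Set (c ⊔ ℓ)
  _∈ℍ_ = MemS._∈_ ℍ-setoid

  -- a line in the left ℍ-vector space ℍ²: { p + λ v : λ ∈ ℍ }, v ≠ 0
  record Line : Set (c ⊔ ℓ) where
    constructor line
    field
      base  : ℍ²
      dir   : ℍ²
      dir≠0 : ¬ (dir ≈² (0ℍ , 0ℍ))

  OnLine : Line → ℍ² → Set (c ⊔ ℓ)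
  OnLine (line (p₁ , p₂) (v₁ , v₂) _) (x , y) =
    ∃ λ (λ' : ℍ) → (x ≈ℍ (p₁ +ℍ (λ' *ℍ v₁))) × (y ≈ℍ (p₂ +ℍ (λ' *ℍ v₂)))

  InGridLine : List ℍ → List ℍ → Line → ℍ² → Set (c ⊔ ℓ)
  InGridLine A B L (x , y) = (x ∈ℍ A) × (y ∈ℍ B) × OnLine L (x , y)

  -- 2 ≤ |(A × B) ∩ ℓ| ≤ 5, written out for a subset of ℍ²:
  -- it has two distinct elements, and every duplicate-free list of its
  -- elements has length at most 5.
  TwoToFive : List ℍ → List ℍ → Line → Set (c ⊔ ℓ)
  TwoToFive A B L =
    (∃ λ P → ∃ λ Q → InGridLine A B L P × InGridLine A B L Q × ¬ (P ≈² Q))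
    × (∀ (S : List ℍ²) → UniqueS.Unique ℍ²-setoid S →
         All (InGridLine A B L) S → length S ℕ.≤ 5)

{-# OPTIONS --safe #-}

-- Let a₁ ≠ a₂ be a closest pair of points of A, b₁, b₂ a farthest pair of points of B, and ℓ the
-- line λ ↦ (a₂, b₂) + λ (a₁ − a₂, b₁ − b₂). Points (x, y), (x′, y′) of (A × B) ∩ ℓ with
-- parameters λ, λ′ satisfy |x − x′| = |λ − λ′| |a₁ − a₂| and |y − y′| = |λ − λ′| |b₁ − b₂|, so
-- minimality and maximality force |λ − λ′| = 1 whenever the points differ. The parameters hence
-- form a unit-distance set in ℍ ≅ ℝ⁴, which has at most five points: after an isometry taking
-- two of them to 0 and 1, the imaginary parts of four more would be four vectors of ℝ³ with a
-- nonsingular Gram matrix.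
--
-- Constructively x = x′ can only be decided under double negation; this suffices because the
-- bound on the length of a list is a decidable statement.

module Submission where

open import Defs
open import Level using (Level; _⊔_)
open import Algebra.Bundles using (CommutativeRing)
import Algebra.Solver.Ring.AlmostCommutativeRing as ACR
open import Data.Empty using (⊥-elim)
open import Data.Fin using (Fin; #_; combine)
open import Data.Integer as ℤ using (ℤ; +_; -[1+_]; _⊖_)
import Data.Integer.Properties as ℤ
open import Data.List using (List; []; _∷_; length; map; _++_; cartesianProduct)
open import Data.List.Relation.Unary.All as All using (All; []; _∷_)
import Data.List.Relation.Unary.All.Properties as All
open import Data.List.Relation.Unary.AllPairs as AllPairs using (AllPairs; []; _∷_)
import Data.List.Relation.Unary.AllPairs.Properties as AllPairs
open import Data.List.Relation.Unary.Any as Any using (here; there)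
import Data.List.Relation.Unary.Any.Properties as Any
import Data.List.Membership.Setoid as Membership
import Data.List.Membership.Setoid.Properties as Membershipₚ
import Data.List.Relation.Unary.Unique.Setoid as UniqueS
import Data.List.Extrema as Extrema
open import Data.Maybe using (Maybe; just; nothing)
open import Data.Nat as ℕ using (ℕ; zero; suc; z≤n; s≤s)
import Data.Nat.Properties as ℕ
open import Data.Product using (∃; _×_; _,_; proj₁; proj₂; uncurry)
open import Data.Product.Relation.Binary.Pointwise.NonDependent using (_×ₛ_)
open import Data.Sum using (inj₁; inj₂)
open import Data.Vec using (Vec; []; _∷_; tabulate)
open import Data.Vec.N-ary using (N-ary; _$ⁿ_)
open import Function using (id; _∘_)
open import Relation.Binary.Bundles using (Setoid; TotalOrder)
open import Relation.Binary.PropositionalEquality as ≡ using (_≡_)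
open import Relation.Nullary using (¬_; yes; no)
open import Relation.Nullary.Decidable using (decidable-stable; ¬¬-excluded-middle)
open import Relation.Nullary.Negation using (¬¬-map)
open import Relation.Unary using (Pred)
open import Relation.Binary.Core using (Rel)

module IntegerRingSolver {c ℓ} (R : CommutativeRing c ℓ) where
  open CommutativeRing R
  open import Algebra.Properties.Ring ring
    using (-‿involutive; -‿distribˡ-*; -‿distribʳ-*; -0#≈0#)
  open import Algebra.Properties.AbelianGroup +-abelianGroup
    using (⁻¹-∙-comm; ⁻¹-anti-homo‿-; //-rightDividesʳ)
  open import Algebra.Properties.Semiring.Mult.TCOptimised semiring
    using (×-homo-+; ×1-homo-*) renaming (_×_ to _×ₙ_)
  open import Relation.Binary.Reasoning.Setoid setoid

  fromℕ : ℕ → Carrier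
  fromℕ n = n ×ₙ 1#

  fromℤ : ℤ → Carrier
  fromℤ (+ n)    = fromℕ n
  fromℤ -[1+ n ] = - fromℕ (suc n)

  private
    fromℤ-cong : ∀ {i j} → i ≡ j → fromℤ i ≈ fromℤ j
    fromℤ-cong ≡.refl = refl

  fromℤ-neg : ∀ i → fromℤ (ℤ.- i) ≈ - fromℤ i
  fromℤ-neg (+ zero)  = sym -0#≈0#
  fromℤ-neg (+ suc n) = refl
  fromℤ-neg -[1+ n ]  = sym (-‿involutive _)

  private
    fromℤ-⊖-≥ : ∀ {m n} → n ℕ.≤ m → fromℤ (m ⊖ n) ≈ fromℕ m - fromℕ n
    fromℤ-⊖-≥ {m} {n} n≤m = begin
      fromℤ (m ⊖ n)                        ≈⟨ fromℤ-cong (ℤ.⊖-≥ n≤m) ⟩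
      fromℕ (m ℕ.∸ n)                      ≈⟨ //-rightDividesʳ (fromℕ n) _ ⟨
      fromℕ (m ℕ.∸ n) + fromℕ n - fromℕ n  ≈⟨ +-congʳ (×-homo-+ 1# (m ℕ.∸ n) n) ⟨
      fromℕ (m ℕ.∸ n ℕ.+ n) - fromℕ n      ≡⟨ ≡.cong (λ k → fromℕ k - fromℕ n) (ℕ.m∸n+n≡m n≤m) ⟩
      fromℕ m - fromℕ n                    ∎

  fromℤ-⊖ : ∀ m n → fromℤ (m ⊖ n) ≈ fromℕ m - fromℕ n
  fromℤ-⊖ m n with ℕ.≤-total n m
  ... | inj₁ n≤m = fromℤ-⊖-≥ n≤m
  ... | inj₂ m≤n = begin
    fromℤ (m ⊖ n)          ≈⟨ fromℤ-cong (ℤ.⊖-swap m n) ⟩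
    fromℤ (ℤ.- (n ⊖ m))    ≈⟨ fromℤ-neg (n ⊖ m) ⟩
    - fromℤ (n ⊖ m)        ≈⟨ -‿cong (fromℤ-⊖-≥ m≤n) ⟩
    - (fromℕ n - fromℕ m)  ≈⟨ ⁻¹-anti-homo‿- _ _ ⟩
    fromℕ m - fromℕ n      ∎

  fromℤ-+ : ∀ i j → fromℤ (i ℤ.+ j) ≈ fromℤ i + fromℤ j
  fromℤ-+ (+ m)    (+ n)    = ×-homo-+ 1# m n
  fromℤ-+ (+ m)    -[1+ n ] = fromℤ-⊖ m (suc n)
  fromℤ-+ -[1+ m ] (+ n)    = trans (fromℤ-⊖ n (suc m)) (+-comm _ _)
  fromℤ-+ -[1+ m ] -[1+ n ] = begin
    fromℤ (-[1+ m ] ℤ.+ -[1+ n ])      ≈⟨ fromℤ-cong (ℤ.neg-distrib-+ (+ suc m) (+ suc n)) ⟨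
    fromℤ (ℤ.- (+ suc m ℤ.+ + suc n))  ≈⟨ fromℤ-neg (+ suc m ℤ.+ + suc n) ⟩
    - fromℕ (suc m ℕ.+ suc n)          ≈⟨ -‿cong (×-homo-+ 1# (suc m) (suc n)) ⟩
    - (fromℕ (suc m) + fromℕ (suc n))  ≈⟨ ⁻¹-∙-comm _ _ ⟨
    - fromℕ (suc m) + - fromℕ (suc n)  ∎

  private
    fromℤ-+* : ∀ m j → fromℤ (+ m ℤ.* j) ≈ fromℕ m * fromℤ j
    fromℤ-+* m (+ n)    = trans (fromℤ-cong (≡.sym (ℤ.pos-* m n))) (×1-homo-* m n)
    fromℤ-+* m -[1+ n ] = begin
      fromℤ (+ m ℤ.* -[1+ n ])       ≈⟨ fromℤ-cong (ℤ.neg-distribʳ-* (+ m) (+ suc n)) ⟨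
      fromℤ (ℤ.- (+ m ℤ.* + suc n))  ≈⟨ fromℤ-neg (+ m ℤ.* + suc n) ⟩
      - fromℤ (+ m ℤ.* + suc n)      ≈⟨ -‿cong (fromℤ-+* m (+ suc n)) ⟩
      - (fromℕ m * fromℕ (suc n))    ≈⟨ -‿distribʳ-* _ _ ⟩
      fromℕ m * - fromℕ (suc n)      ∎

  fromℤ-* : ∀ i j → fromℤ (i ℤ.* j) ≈ fromℤ i * fromℤ j
  fromℤ-* (+ m)    j = fromℤ-+* m j
  fromℤ-* -[1+ m ] j = begin
    fromℤ (-[1+ m ] ℤ.* j)       ≈⟨ fromℤ-cong (ℤ.neg-distribˡ-* (+ suc m) j) ⟨
    fromℤ (ℤ.- (+ suc m ℤ.* j))  ≈⟨ fromℤ-neg (+ suc m ℤ.* j) ⟩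
    - fromℤ (+ suc m ℤ.* j)      ≈⟨ -‿cong (fromℤ-+* (suc m) j) ⟩
    - (fromℕ (suc m) * fromℤ j)  ≈⟨ -‿distribˡ-* _ _ ⟩
    - fromℕ (suc m) * fromℤ j    ∎

  fromℤ-homomorphism : ℤ.+-*-rawRing ACR.-Raw-AlmostCommutative⟶ ACR.fromCommutativeRing R
  fromℤ-homomorphism = record
    { ⟦_⟧ = fromℤ ; +-homo = fromℤ-+ ; *-homo = fromℤ-* ; -‿homo = fromℤ-neg
    ; 0-homo = refl ; 1-homo = refl }

  fromℤ-≟ : ∀ i j → Maybe (fromℤ i ≈ fromℤ j)
  fromℤ-≟ i j with i ℤ.≟ j
  ... | yes ≡.refl = just refl
  ... | no _       = nothing

  open import Algebra.Solver.Ring ℤ.+-*-rawRing (ACR.fromCommutativeRing R) fromℤ-homomorphism fromℤ-≟ public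

module OrderedFieldProperties {c ℓ} (R : RealField c ℓ) where
  open RealField R renaming (_≤_ to infix 4 _≤_)
  open IntegerRingSolver commutativeRing
  open import Algebra.Properties.Ring ring using ([y-z]x≈yx-zx)
  open import Algebra.Properties.AbelianGroup +-abelianGroup using (x∙y⁻¹≈ε⇒x≈y; x≈y⇒x∙y⁻¹≈ε)
  open import Algebra.Properties.Semiring.Mult.TCOptimised semiring using (×-homo-+)

  totalOrder : TotalOrder c ℓ ℓ
  totalOrder = record { isTotalOrder = isTotalOrder }

  private module ≤ = TotalOrder totalOrder
  open import Relation.Binary.Reasoning.PartialOrder ≤.poset

  x≤y⇒0≤y-x : ∀ {x y} → x ≤ y → 0# ≤ y - x
  x≤y⇒0≤y-x {x} {y} x≤y = begin
    0#     ≈⟨ -‿inverseʳ x ⟨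
    x - x  ≤⟨ +-monoˡ-≤ (- x) x≤y ⟩
    y - x  ∎

  0≤y-x⇒x≤y : ∀ {x y} → 0# ≤ y - x → x ≤ y
  0≤y-x⇒x≤y {x} {y} 0≤y-x = begin
    x            ≈⟨ +-identityˡ x ⟨
    0# + x       ≤⟨ +-monoˡ-≤ x 0≤y-x ⟩
    y - x + x    ≈⟨ solve 2 (λ x y → y :- x :+ x := y) refl x y ⟩
    y            ∎

  x≤x+y : ∀ x {y} → 0# ≤ y → x ≤ x + y
  x≤x+y x {y} 0≤y = begin
    x       ≈⟨ +-identityˡ x ⟨
    0# + x  ≤⟨ +-monoˡ-≤ x 0≤y ⟩
    y + x   ≈⟨ +-comm y x ⟩
    x + y   ∎

  +-nonneg : ∀ {x y} → 0# ≤ x → 0# ≤ y → 0# ≤ x + y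
  +-nonneg {x} 0≤x 0≤y = ≤.trans 0≤x (x≤x+y x 0≤y)

  x*x-nonneg : ∀ x → 0# ≤ x * x
  x*x-nonneg x with ≤.total 0# x
  ... | inj₁ 0≤x = *-nonneg 0≤x 0≤x
  ... | inj₂ x≤0 = begin
    0#         ≤⟨ *-nonneg 0≤-x 0≤-x ⟩
    - x * - x  ≈⟨ solve 1 (λ x → :- x :* :- x := x :* x) refl x ⟩
    x * x      ∎
    where
    0≤-x : 0# ≤ - x
    0≤-x = ≤.≤-respʳ-≈ (+-identityˡ (- x)) (x≤y⇒0≤y-x x≤0)

  0≤1 : 0# ≤ 1#
  0≤1 = ≤.≤-respʳ-≈ (*-identityʳ 1#) (x*x-nonneg 1#)

  +-nonneg-≈0 : ∀ {x y} → 0# ≤ x → 0# ≤ y → x + y ≈ 0# → x ≈ 0# × y ≈ 0#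
  +-nonneg-≈0 {x} {y} 0≤x 0≤y x+y≈0 =
    ≤.antisym (≤.≤-respʳ-≈ x+y≈0 (x≤x+y x 0≤y)) 0≤x ,
    ≤.antisym (≤.≤-respʳ-≈ (trans (+-comm y x) x+y≈0) (x≤x+y y 0≤x)) 0≤y

  x*x≈0⇒¬¬x≈0 : ∀ {x} → x * x ≈ 0# → ¬ ¬ x ≈ 0#
  x*x≈0⇒¬¬x≈0 {x} x*x≈0 x≉0 with inverse x x≉0
  ... | y , x*y≈1 = 0≉1 (begin-equality
    0#                ≈⟨ zeroˡ (y * y) ⟨
    0# * (y * y)      ≈⟨ *-congʳ x*x≈0 ⟨
    x * x * (y * y)   ≈⟨ solve 2 (λ x y → x :* x :* (y :* y) := x :* y :* (x :* y)) refl x y ⟩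
    x * y * (x * y)   ≈⟨ *-cong x*y≈1 x*y≈1 ⟩
    1# * 1#           ≈⟨ *-identityˡ 1# ⟩
    1#                ∎)

  x*y≈0⇒x≈0 : ∀ {x y} → ¬ y ≈ 0# → x * y ≈ 0# → x ≈ 0#
  x*y≈0⇒x≈0 {x} {y} y≉0 x*y≈0 with inverse y y≉0
  ... | z , y*z≈1 = begin-equality
    x            ≈⟨ *-identityʳ x ⟨
    x * 1#       ≈⟨ *-congˡ y*z≈1 ⟨
    x * (y * z)  ≈⟨ *-assoc x y z ⟨
    x * y * z    ≈⟨ *-congʳ x*y≈0 ⟩
    0# * z       ≈⟨ zeroˡ z ⟩
    0#           ∎

  *-monoʳ-≤-nonneg : ∀ {x y} z → 0# ≤ z → x ≤ y → x * z ≤ y * z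
  *-monoʳ-≤-nonneg {x} {y} z 0≤z x≤y =
    0≤y-x⇒x≤y (≤.≤-respʳ-≈ ([y-z]x≈yx-zx z y x) (*-nonneg (x≤y⇒0≤y-x x≤y) 0≤z))

  *-cancelʳ-≤-pos : ∀ {x y z} → 0# ≤ z → ¬ z ≈ 0# → x * z ≤ y * z → x ≤ y
  *-cancelʳ-≤-pos {x} {y} {z} 0≤z z≉0 xz≤yz with ≤.total x y
  ... | inj₁ x≤y = x≤y
  ... | inj₂ y≤x = ≤.reflexive (x∙y⁻¹≈ε⇒x≈y x y (x*y≈0⇒x≈0 z≉0 [x-y]z≈0))
    where
    [x-y]z≈0 : (x - y) * z ≈ 0#
    [x-y]z≈0 = trans ([y-z]x≈yx-zx z x y)
      (x≈y⇒x∙y⁻¹≈ε (≤.antisym xz≤yz (*-monoʳ-≤-nonneg z 0≤z y≤x)))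

  fromℕ-nonneg : ∀ n → 0# ≤ fromℕ n
  fromℕ-nonneg zero    = ≤.refl
  fromℕ-nonneg (suc n) = ≤.≤-respʳ-≈ (sym (×-homo-+ 1# 1 n)) (+-nonneg 0≤1 (fromℕ-nonneg n))

  fromℕ-suc≉0 : ∀ n → ¬ fromℕ (suc n) ≈ 0#
  fromℕ-suc≉0 n 1+n≈0 = 0≉1 (≤.antisym 0≤1 (begin
    1#                ≤⟨ x≤x+y 1# (fromℕ-nonneg n) ⟩
    1# + fromℕ n      ≈⟨ ×-homo-+ 1# 1 n ⟨
    fromℕ (suc n)     ≈⟨ 1+n≈0 ⟩
    0#                ∎))

module ExtremalPairs {a ℓ₁ b ℓ₂ ℓ₃} (S : Setoid a ℓ₁) (T : TotalOrder b ℓ₂ ℓ₃) where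
  open Setoid S renaming (Carrier to X)
  open TotalOrder T using (_≤_) renaming (Carrier to V; _≈_ to _≈ᵛ_)
  private module ≤ = TotalOrder T
  open Membership S using (_∈_)
  open Membership (S ×ₛ S) using () renaming (_∈_ to _∈²_)
  open Extrema T using (argmin; argmax; f[argmin]≤f[xs]; f[xs]≤f[argmax]; argmin-all; argmax-all)

  offDiagonal : List X → List (X × X)
  offDiagonal []       = []
  offDiagonal (x ∷ xs) = map (x ,_) xs ++ map (_, x) xs ++ offDiagonal xs

  ∈-offDiagonal⁺ : ∀ {x y xs} → x ∈ xs → y ∈ xs → ¬ x ≈ y → (x , y) ∈² offDiagonal xs
  ∈-offDiagonal⁺ (here x≈z)  (here y≈z)  x≉y = ⊥-elim (x≉y (trans x≈z (sym y≈z)))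
  ∈-offDiagonal⁺ (here x≈z)  (there y∈zs) _  =
    Any.++⁺ˡ (Any.map⁺ (Any.map (x≈z ,_) y∈zs))
  ∈-offDiagonal⁺ {xs = z ∷ zs} (there x∈zs) (here y≈z) _ =
    Any.++⁺ʳ (map (z ,_) zs) (Any.++⁺ˡ (Any.map⁺ (Any.map (_, y≈z) x∈zs)))
  ∈-offDiagonal⁺ {xs = z ∷ zs} (there x∈zs) (there y∈zs) x≉y =
    Any.++⁺ʳ (map (z ,_) zs) (Any.++⁺ʳ (map (_, z) zs) (∈-offDiagonal⁺ x∈zs y∈zs x≉y))

  DistinctIn : List X → X × X → Set (a ⊔ ℓ₁)
  DistinctIn xs (x , y) = x ∈ xs × y ∈ xs × ¬ x ≈ y

  offDiagonal-distinct : ∀ {xs} → UniqueS.Unique S xs → All (DistinctIn xs) (offDiagonal xs)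
  offDiagonal-distinct {[]}     []             = []
  offDiagonal-distinct {z ∷ zs} (z≉zs ∷ uzs) =
    All.++⁺ (All.map⁺ (All.zipWith (λ (w∈zs , z≉w) → here refl , there w∈zs , z≉w) (zs⊆zs , z≉zs)))
      (All.++⁺ (All.map⁺ (All.zipWith (λ (w∈zs , z≉w) → there w∈zs , here refl , z≉w ∘ sym) (zs⊆zs , z≉zs)))
        (All.map (λ (x∈zs , y∈zs , x≉y) → there x∈zs , there y∈zs , x≉y) (offDiagonal-distinct uzs)))
    where
    zs⊆zs : All (_∈ zs) zs
    zs⊆zs = All.tabulateₛ S id

  module _ (d : X → X → V) (d-cong : ∀ {x x′ y y′} → x ≈ x′ → y ≈ y′ → d x y ≈ᵛ d x′ y′) where

    record ClosestPair (xs : List X) : Set (a ⊔ ℓ₁ ⊔ ℓ₃) where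
      field
        x y     : X
        x∈xs    : x ∈ xs
        y∈xs    : y ∈ xs
        x≉y     : ¬ x ≈ y
        minimal : ∀ {x′ y′} → x′ ∈ xs → y′ ∈ xs → ¬ x′ ≈ y′ → d x y ≤ d x′ y′

    closestPair : ∀ {x y xs} → UniqueS.Unique S (x ∷ y ∷ xs) → ClosestPair (x ∷ y ∷ xs)
    closestPair {x} {y} {xs} u@((x≉y ∷ _) ∷ _) = record
      { x = proj₁ p ; y = proj₂ p
      ; x∈xs = proj₁ p-distinct ; y∈xs = proj₁ (proj₂ p-distinct) ; x≉y = proj₂ (proj₂ p-distinct)
      ; minimal = λ x′∈ y′∈ x′≉y′ →
          All.lookupₛ (S ×ₛ S) d[p]≤-resp (f[argmin]≤f[xs] (x , y) pairs) (∈-offDiagonal⁺ x′∈ y′∈ x′≉y′)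
      }
      where
      pairs : List (X × X)
      pairs = offDiagonal (x ∷ y ∷ xs)
      p : X × X
      p = argmin (uncurry d) (x , y) pairs
      d[p]≤-resp : ∀ {q q′} → Setoid._≈_ (S ×ₛ S) q q′ →
                   uncurry d p ≤ uncurry d q → uncurry d p ≤ uncurry d q′
      d[p]≤-resp (e₁ , e₂) = ≤.≤-respʳ-≈ (d-cong e₁ e₂)
      p-distinct : DistinctIn (x ∷ y ∷ xs) p
      p-distinct = argmin-all (uncurry d) (here refl , there (here refl) , x≉y) (offDiagonal-distinct u)

    record FarthestPair (xs : List X) : Set (a ⊔ ℓ₁ ⊔ ℓ₃) where
      field
        x y     : X
        x∈xs    : x ∈ xs
        y∈xs    : y ∈ xs
        maximal : ∀ {x′ y′} → x′ ∈ xs → y′ ∈ xs → d x′ y′ ≤ d x y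

    farthestPair : ∀ {x xs} → FarthestPair (x ∷ xs)
    farthestPair {x} {xs} = record
      { x = proj₁ p ; y = proj₂ p ; x∈xs = proj₁ p-members ; y∈xs = proj₂ p-members
      ; maximal = λ x′∈ y′∈ →
          All.lookupₛ (S ×ₛ S) ≤d[p]-resp (f[xs]≤f[argmax] (x , x) pairs)
            (Membershipₚ.∈-cartesianProduct⁺ S S x′∈ y′∈)
      }
      where
      pairs : List (X × X)
      pairs = cartesianProduct (x ∷ xs) (x ∷ xs)
      p : X × X
      p = argmax (uncurry d) (x , x) pairs
      ≤d[p]-resp : ∀ {q q′} → Setoid._≈_ (S ×ₛ S) q q′ →
                   uncurry d q ≤ uncurry d p → uncurry d q′ ≤ uncurry d p
      ≤d[p]-resp (e₁ , e₂) = ≤.≤-respˡ-≈ (d-cong e₁ e₂)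
      p-members : proj₁ p ∈ (x ∷ xs) × proj₂ p ∈ (x ∷ xs)
      p-members = argmax-all (uncurry d) {P = λ (u , v) → u ∈ (x ∷ xs) × v ∈ (x ∷ xs)}
        (here refl , here refl) (All.tabulateₛ (S ×ₛ S) (Membershipₚ.∈-cartesianProduct⁻ S S (x ∷ xs) (x ∷ xs)))

module _ {a p} {A : Set a} {P : Pred A p} where

  ¬¬-all : ∀ {xs} → All (λ x → ¬ ¬ P x) xs → ¬ ¬ All P xs
  ¬¬-all []         k = k []
  ¬¬-all (px ∷ pxs) k = px λ px′ → ¬¬-all pxs λ pxs′ → k (px′ ∷ pxs′)

module _ {a r} {A : Set a} {R : Rel A r} where

  ¬¬-allPairs : ∀ {xs} → AllPairs (λ x y → ¬ ¬ R x y) xs → ¬ ¬ AllPairs R xs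
  ¬¬-allPairs []         k = k []
  ¬¬-allPairs (rx ∷ rxs) k = ¬¬-all rx λ rx′ → ¬¬-allPairs rxs λ rxs′ → k (rx′ ∷ rxs′)

module _ {a b p} {A : Set a} {B : Set b} {P : Pred A p} (f : ∀ {x} → P x → B) where

  length-reduce : ∀ {xs} (pxs : All P xs) → length (All.reduce f pxs) ≡ length xs
  length-reduce []        = ≡.refl
  length-reduce (_ ∷ pxs) = ≡.cong suc (length-reduce pxs)

  module _ {r q} {R : Rel A r} {Q : Rel B q}
           (f-pres : ∀ {x y} (px : P x) (py : P y) → R x y → Q (f px) (f py)) where

    all-reduce : ∀ {x xs} (px : P x) → All (R x) xs → (pxs : All P xs) → All (Q (f px)) (All.reduce f pxs)
    all-reduce px []         []         = []
    all-reduce px (rx ∷ rxs) (py ∷ pxs) = f-pres px py rx ∷ all-reduce px rxs pxs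

    allPairs-reduce : ∀ {xs} → AllPairs R xs → (pxs : All P xs) → AllPairs Q (All.reduce f pxs)
    allPairs-reduce []         []         = []
    allPairs-reduce (rx ∷ rxs) (px ∷ pxs) = all-reduce px rx pxs ∷ allPairs-reduce rxs pxs

module QuaternionAlgebra {c ℓ} (R : RealField c ℓ) where
  open RealField R renaming (_≤_ to infix 4 _≤_)
  open Quaternions R renaming (_+ℍ_ to infixl 6 _+ℍ_; _*ℍ_ to infixl 7 _*ℍ_; _≈ℍ_ to infix 4 _≈ℍ_)
  open IntegerRingSolver commutativeRing
  open OrderedFieldProperties R
  open import Algebra.Properties.AbelianGroup +-abelianGroup using (x∙y⁻¹≈ε⇒x≈y)

  infixl 6 _-ℍ_
  _-ℍ_ : ℍ → ℍ → ℍ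
  quat a b c′ d -ℍ quat a′ b′ c″ d′ = quat (a - a′) (b - b′) (c′ - c″) (d - d′)

  conj : ℍ → ℍ
  conj (quat a b c′ d) = quat a (- b) (- c′) (- d)

  1ℍ : ℍ
  1ℍ = quat 1# 0# 0# 0#

  N : ℍ → Carrier
  N (quat a b c′ d) = a * a + b * b + c′ * c′ + d * d

  dist² : ℍ → ℍ → Carrier
  dist² p q = N (p -ℍ q)

  imDot : ℍ → ℍ → Carrier
  imDot (quat _ b c′ d) (quat _ b′ c″ d′) = b * b′ + c′ * c″ + d * d′

  det₃ : Carrier → Carrier → Carrier → Carrier → Carrier → Carrier → Carrier → Carrier → Carrier → Carrier
  det₃ a b c′ d e f g h i = a * (e * i - f * h) - b * (d * i - f * g) + c′ * (d * h - e * g)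

  imDet : ℍ → ℍ → ℍ → Carrier
  imDet p q r = det₃ (ii p) (jj p) (kk p) (ii q) (jj q) (kk q) (ii r) (jj r) (kk r)

  -- Quaternions with polynomial components, with a syntactic twin of each operation on ℍ so that
  -- ⟦_⟧ᴴ commutes with the operations definitionally: identities of quaternion expressions then
  -- follow componentwise from the ring solver. Quaternion variable i occupies the environment
  -- slots 4i, …, 4i + 3.
  record ℍᴱ (n : ℕ) : Set where
    constructor quatᴱ
    field reᴱ iiᴱ jjᴱ kkᴱ : Polynomial n
  open ℍᴱ

  infixl 6 _+ᴱ_ _-ᴱ_
  infixl 7 _*ᴱ_

  _+ᴱ_ _-ᴱ_ _*ᴱ_ : ∀ {n} → ℍᴱ n → ℍᴱ n → ℍᴱ n
  quatᴱ a b c′ d +ᴱ quatᴱ a′ b′ c″ d′ = quatᴱ (a :+ a′) (b :+ b′) (c′ :+ c″) (d :+ d′)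
  quatᴱ a b c′ d -ᴱ quatᴱ a′ b′ c″ d′ = quatᴱ (a :- a′) (b :- b′) (c′ :- c″) (d :- d′)
  quatᴱ a₁ b₁ c₁ d₁ *ᴱ quatᴱ a₂ b₂ c₂ d₂ = quatᴱ
    (a₁ :* a₂ :- b₁ :* b₂ :- c₁ :* c₂ :- d₁ :* d₂)
    (a₁ :* b₂ :+ b₁ :* a₂ :+ c₁ :* d₂ :- d₁ :* c₂)
    (a₁ :* c₂ :- b₁ :* d₂ :+ c₁ :* a₂ :+ d₁ :* b₂)
    (a₁ :* d₂ :+ b₁ :* c₂ :- c₁ :* b₂ :+ d₁ :* a₂)

  conjᴱ : ∀ {n} → ℍᴱ n → ℍᴱ n
  conjᴱ (quatᴱ a b c′ d) = quatᴱ a (:- b) (:- c′) (:- d)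

  0ᴱ 1ᴱ : ∀ {n} → ℍᴱ n
  0ᴱ = quatᴱ (con (+ 0)) (con (+ 0)) (con (+ 0)) (con (+ 0))
  1ᴱ = quatᴱ (con (+ 1)) (con (+ 0)) (con (+ 0)) (con (+ 0))

  Nᴱ : ∀ {n} → ℍᴱ n → Polynomial n
  Nᴱ (quatᴱ a b c′ d) = a :* a :+ b :* b :+ c′ :* c′ :+ d :* d

  imDotᴱ : ∀ {n} → ℍᴱ n → ℍᴱ n → Polynomial n
  imDotᴱ (quatᴱ _ b c′ d) (quatᴱ _ b′ c″ d′) = b :* b′ :+ c′ :* c″ :+ d :* d′

  det₃ᴱ : ∀ {n} → Polynomial n → Polynomial n → Polynomial n → Polynomial n → Polynomial n →
          Polynomial n → Polynomial n → Polynomial n → Polynomial n → Polynomial n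
  det₃ᴱ a b c′ d e f g h i = a :* (e :* i :- f :* h) :- b :* (d :* i :- f :* g) :+ c′ :* (d :* h :- e :* g)

  imDetᴱ : ∀ {n} → ℍᴱ n → ℍᴱ n → ℍᴱ n → Polynomial n
  imDetᴱ p q r = det₃ᴱ (iiᴱ p) (jjᴱ p) (kkᴱ p) (iiᴱ q) (jjᴱ q) (kkᴱ q) (iiᴱ r) (jjᴱ r) (kkᴱ r)

  ⟦_⟧ᴴ : ∀ {n} → ℍᴱ n → Vec Carrier n → ℍ
  ⟦ quatᴱ a b c′ d ⟧ᴴ ρ = quat (⟦ a ⟧ ρ) (⟦ b ⟧ ρ) (⟦ c′ ⟧ ρ) (⟦ d ⟧ ρ)

  components : ∀ {k} → Vec ℍ k → Vec Carrier (k ℕ.* 4)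
  components []       = []
  components (q ∷ qs) = re q ∷ ii q ∷ jj q ∷ kk q ∷ components qs

  varᴴ : ∀ {k} → Fin k → ℍᴱ (k ℕ.* 4)
  varᴴ i = quatᴱ (var (combine i (# 0))) (var (combine i (# 1))) (var (combine i (# 2))) (var (combine i (# 3)))

  closeᴴ : ∀ {a} {A : Set a} k → N-ary k (ℍᴱ (k ℕ.* 4)) A → A
  closeᴴ k f = f $ⁿ tabulate varᴴ

  solveᴿ : ∀ {k} (qs : Vec ℍ k) (f : N-ary k (ℍᴱ (k ℕ.* 4)) (Polynomial (k ℕ.* 4) × Polynomial (k ℕ.* 4))) →
           let ρ = components qs; e₁ = proj₁ (closeᴴ k f); e₂ = proj₂ (closeᴴ k f) in
           ⟦ e₁ ⟧↓ ρ ≈ ⟦ e₂ ⟧↓ ρ → ⟦ e₁ ⟧ ρ ≈ ⟦ e₂ ⟧ ρ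
  solveᴿ {k} qs f = prove (components qs) (proj₁ (closeᴴ k f)) (proj₂ (closeᴴ k f))

  solveᴴ : ∀ {k} (qs : Vec ℍ k) (f : N-ary k (ℍᴱ (k ℕ.* 4)) (ℍᴱ (k ℕ.* 4) × ℍᴱ (k ℕ.* 4))) →
           let ρ = components qs; e₁ = proj₁ (closeᴴ k f); e₂ = proj₂ (closeᴴ k f) in
           (⟦ reᴱ e₁ ⟧↓ ρ ≈ ⟦ reᴱ e₂ ⟧↓ ρ) × (⟦ iiᴱ e₁ ⟧↓ ρ ≈ ⟦ iiᴱ e₂ ⟧↓ ρ) ×
           (⟦ jjᴱ e₁ ⟧↓ ρ ≈ ⟦ jjᴱ e₂ ⟧↓ ρ) × (⟦ kkᴱ e₁ ⟧↓ ρ ≈ ⟦ kkᴱ e₂ ⟧↓ ρ) →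
           ⟦ e₁ ⟧ᴴ ρ ≈ℍ ⟦ e₂ ⟧ᴴ ρ
  solveᴴ {k} qs f (re≈ , ii≈ , jj≈ , kk≈) =
    prove ρ (reᴱ e₁) (reᴱ e₂) re≈ , prove ρ (iiᴱ e₁) (iiᴱ e₂) ii≈ ,
    prove ρ (jjᴱ e₁) (jjᴱ e₂) jj≈ , prove ρ (kkᴱ e₁) (kkᴱ e₂) kk≈
    where
    ρ : Vec Carrier (k ℕ.* 4)
    ρ = components qs
    e₁ e₂ : ℍᴱ (k ℕ.* 4)
    e₁ = proj₁ (closeᴴ k f)
    e₂ = proj₂ (closeᴴ k f)

  private
    refl⁴ : ∀ {x y z w} → x ≈ x × y ≈ y × z ≈ z × w ≈ w
    refl⁴ = refl , refl , refl , refl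

  line-at-0 : ∀ p u → p ≈ℍ p +ℍ 0ℍ *ℍ u
  line-at-0 p u = solveᴴ (p ∷ u ∷ []) (λ p u → p , p +ᴱ 0ᴱ *ᴱ u) refl⁴

  line-at-1 : ∀ p q → p ≈ℍ q +ℍ 1ℍ *ℍ (p -ℍ q)
  line-at-1 p q = solveᴴ (p ∷ q ∷ []) (λ p q → p , q +ᴱ 1ᴱ *ᴱ (p -ᴱ q)) refl⁴

  line-diff : ∀ a l l′ u → (a +ℍ l *ℍ u) -ℍ (a +ℍ l′ *ℍ u) ≈ℍ (l -ℍ l′) *ℍ u
  line-diff a l l′ u =
    solveᴴ (a ∷ l ∷ l′ ∷ u ∷ []) (λ a l l′ u → (a +ᴱ l *ᴱ u) -ᴱ (a +ᴱ l′ *ᴱ u) , (l -ᴱ l′) *ᴱ u) refl⁴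

  N-* : ∀ p q → N (p *ℍ q) ≈ N p * N q
  N-* p q = solveᴿ (p ∷ q ∷ []) (λ p q → Nᴱ (p *ᴱ q) , Nᴱ p :* Nᴱ q) refl

  N-*-conj : ∀ p q → N (p *ℍ conj q) ≈ N p * N q
  N-*-conj p q = solveᴿ (p ∷ q ∷ []) (λ p q → Nᴱ (p *ᴱ conjᴱ q) , Nᴱ p :* Nᴱ q) refl

  N-*-conj-diff : ∀ p q r → N (p *ℍ conj r -ℍ q *ℍ conj r) ≈ N (p -ℍ q) * N r
  N-*-conj-diff p q r =
    solveᴿ (p ∷ q ∷ r ∷ []) (λ p q r → Nᴱ (p *ᴱ conjᴱ r -ᴱ q *ᴱ conjᴱ r) , Nᴱ (p -ᴱ q) :* Nᴱ r) refl

  N-diff-diff : ∀ a p q → N ((a -ℍ p) -ℍ (a -ℍ q)) ≈ N (p -ℍ q)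
  N-diff-diff a p q = solveᴿ (a ∷ p ∷ q ∷ []) (λ a p q → Nᴱ ((a -ᴱ p) -ᴱ (a -ᴱ q)) , Nᴱ (p -ᴱ q)) refl

  re-*-conj-polarisation : ∀ p q → re (p *ℍ conj q) + re (p *ℍ conj q) ≈ N p + N q - N (q -ℍ p)
  re-*-conj-polarisation p q = solveᴿ (p ∷ q ∷ [])
    (λ p q → reᴱ (p *ᴱ conjᴱ q) :+ reᴱ (p *ᴱ conjᴱ q) , Nᴱ p :+ Nᴱ q :- Nᴱ (q -ᴱ p)) refl

  N-self-diff : ∀ p → N (p -ℍ p) ≈ 0#
  N-self-diff p = solveᴿ (p ∷ []) (λ p → Nᴱ (p -ᴱ p) , con (+ 0)) refl

  imDot-comm : ∀ p q → imDot p q ≈ imDot q p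
  imDot-comm p q = solveᴿ (p ∷ q ∷ []) (λ p q → imDotᴱ p q , imDotᴱ q p) refl

  imDot-self : ∀ p → fromℕ 4 * imDot p p ≈ fromℕ 4 * N p - (re p + re p) * (re p + re p)
  imDot-self p = solveᴿ (p ∷ [])
    (λ p → con (+ 4) :* imDotᴱ p p , con (+ 4) :* Nᴱ p :- (reᴱ p :+ reᴱ p) :* (reᴱ p :+ reᴱ p)) refl

  imDot-polarisation : ∀ p q →
    fromℕ 4 * imDot p q ≈ fromℕ 2 * (N p + N q - N (p -ℍ q)) - (re p + re p) * (re q + re q)
  imDot-polarisation p q = solveᴿ (p ∷ q ∷ [])
    (λ p q → con (+ 4) :* imDotᴱ p q ,
             con (+ 2) :* (Nᴱ p :+ Nᴱ q :- Nᴱ (p -ᴱ q)) :- (reᴱ p :+ reᴱ p) :* (reᴱ q :+ reᴱ q)) refl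

  imDet-cauchyBinet : ∀ x y z w → fromℕ 64 * (imDet x y z * imDet x y w) ≈
    det₃ (fromℕ 4 * imDot x x) (fromℕ 4 * imDot x y) (fromℕ 4 * imDot x w)
         (fromℕ 4 * imDot y x) (fromℕ 4 * imDot y y) (fromℕ 4 * imDot y w)
         (fromℕ 4 * imDot z x) (fromℕ 4 * imDot z y) (fromℕ 4 * imDot z w)
  imDet-cauchyBinet x y z w = solveᴿ (x ∷ y ∷ z ∷ w ∷ [])
    (λ x y z w → con (+ 64) :* (imDetᴱ x y z :* imDetᴱ x y w) ,
      det₃ᴱ (con (+ 4) :* imDotᴱ x x) (con (+ 4) :* imDotᴱ x y) (con (+ 4) :* imDotᴱ x w)
            (con (+ 4) :* imDotᴱ y x) (con (+ 4) :* imDotᴱ y y) (con (+ 4) :* imDotᴱ y w)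
            (con (+ 4) :* imDotᴱ z x) (con (+ 4) :* imDotᴱ z y) (con (+ 4) :* imDotᴱ z w)) refl

  -ℍ-cong : ∀ {p p′ q q′} → p ≈ℍ p′ → q ≈ℍ q′ → p -ℍ q ≈ℍ p′ -ℍ q′
  -ℍ-cong (a≈ , b≈ , c≈ , d≈) (a′≈ , b′≈ , c′≈ , d′≈) =
    +-cong a≈ (-‿cong a′≈) , +-cong b≈ (-‿cong b′≈) , +-cong c≈ (-‿cong c′≈) , +-cong d≈ (-‿cong d′≈)

  N-cong : ∀ {p q} → p ≈ℍ q → N p ≈ N q
  N-cong (a≈ , b≈ , c≈ , d≈) =
    +-cong (+-cong (+-cong (*-cong a≈ a≈) (*-cong b≈ b≈)) (*-cong c≈ c≈)) (*-cong d≈ d≈)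

  dist²-cong : ∀ {p p′ q q′} → p ≈ℍ p′ → q ≈ℍ q′ → dist² p q ≈ dist² p′ q′
  dist²-cong p≈ q≈ = N-cong (-ℍ-cong p≈ q≈)

  det₃-cong : ∀ {a a′ b b′ c′ c″ d d′ e e′ f f′ g g′ h h′ i i′} →
    a ≈ a′ → b ≈ b′ → c′ ≈ c″ → d ≈ d′ → e ≈ e′ → f ≈ f′ → g ≈ g′ → h ≈ h′ → i ≈ i′ →
    det₃ a b c′ d e f g h i ≈ det₃ a′ b′ c″ d′ e′ f′ g′ h′ i′
  det₃-cong a≈ b≈ c≈ d≈ e≈ f≈ g≈ h≈ i≈ =
    +-cong (+-cong (*-cong a≈ (minor e≈ i≈ f≈ h≈)) (-‿cong (*-cong b≈ (minor d≈ i≈ f≈ g≈))))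
           (*-cong c≈ (minor d≈ h≈ e≈ g≈))
    where
    minor : ∀ {w w′ x x′ y y′ z z′} → w ≈ w′ → x ≈ x′ → y ≈ y′ → z ≈ z′ → w * x - y * z ≈ w′ * x′ - y′ * z′
    minor w≈ x≈ y≈ z≈ = +-cong (*-cong w≈ x≈) (-‿cong (*-cong y≈ z≈))

  N-nonneg : ∀ q → 0# ≤ N q
  N-nonneg (quat a b c′ d) =
    +-nonneg (+-nonneg (+-nonneg (x*x-nonneg a) (x*x-nonneg b)) (x*x-nonneg c′)) (x*x-nonneg d)

  N≈0⇒¬¬≈0ℍ : ∀ {q} → N q ≈ 0# → ¬ ¬ q ≈ℍ 0ℍ
  N≈0⇒¬¬≈0ℍ {quat a b c′ d} N≈0 q≉0 =
    let a²+b²+c²≈0 , d²≈0 = +-nonneg-≈0 (+-nonneg (+-nonneg a²≥0 b²≥0) c²≥0) d²≥0 N≈0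
        a²+b²≈0 , c²≈0    = +-nonneg-≈0 (+-nonneg a²≥0 b²≥0) c²≥0 a²+b²+c²≈0
        a²≈0 , b²≈0       = +-nonneg-≈0 a²≥0 b²≥0 a²+b²≈0
    in x*x≈0⇒¬¬x≈0 a²≈0 λ a≈0 → x*x≈0⇒¬¬x≈0 b²≈0 λ b≈0 →
       x*x≈0⇒¬¬x≈0 c²≈0 λ c≈0 → x*x≈0⇒¬¬x≈0 d²≈0 λ d≈0 →
       q≉0 (a≈0 , b≈0 , c≈0 , d≈0)
    where
    a²≥0 : 0# ≤ a * a
    a²≥0 = x*x-nonneg a
    b²≥0 : 0# ≤ b * b
    b²≥0 = x*x-nonneg b
    c²≥0 : 0# ≤ c′ * c′
    c²≥0 = x*x-nonneg c′
    d²≥0 : 0# ≤ d * d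
    d²≥0 = x*x-nonneg d

  -ℍ≈0⇒≈ : ∀ {p q} → p -ℍ q ≈ℍ 0ℍ → p ≈ℍ q
  -ℍ≈0⇒≈ (a≈0 , b≈0 , c≈0 , d≈0) =
    x∙y⁻¹≈ε⇒x≈y _ _ a≈0 , x∙y⁻¹≈ε⇒x≈y _ _ b≈0 , x∙y⁻¹≈ε⇒x≈y _ _ c≈0 , x∙y⁻¹≈ε⇒x≈y _ _ d≈0

  dist²≈0⇒¬¬≈ : ∀ {p q} → dist² p q ≈ 0# → ¬ ¬ p ≈ℍ q
  dist²≈0⇒¬¬≈ = ¬¬-map -ℍ≈0⇒≈ ∘ N≈0⇒¬¬≈0ℍ

  ≈⇒dist²≈0 : ∀ {p q} → p ≈ℍ q → dist² p q ≈ 0#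
  ≈⇒dist²≈0 {p} {q} p≈q = trans (dist²-cong {q = q} p≈q (Setoid.refl ℍ-setoid)) (N-self-diff q)

  dist²-onLine : ∀ {a l l′ u x x′} → x ≈ℍ a +ℍ l *ℍ u → x′ ≈ℍ a +ℍ l′ *ℍ u → dist² x x′ ≈ dist² l l′ * N u
  dist²-onLine {a} {l} {l′} {u} x≈ x′≈ =
    trans (dist²-cong x≈ x′≈) (trans (N-cong (line-diff a l l′ u)) (N-* (l -ℍ l′) u))

module UnitDistanceSets {c ℓ} (R : RealField c ℓ) where
  open RealField R renaming (_≤_ to infix 4 _≤_)
  open Quaternions R renaming (_+ℍ_ to infixl 6 _+ℍ_; _*ℍ_ to infixl 7 _*ℍ_; _≈ℍ_ to infix 4 _≈ℍ_)
  open IntegerRingSolver commutativeRing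
  open OrderedFieldProperties R
  open QuaternionAlgebra R
  open import Algebra.Properties.AbelianGroup +-abelianGroup using (//-rightDividesʳ)
  open import Relation.Binary.Reasoning.Setoid setoid

  UnitApart : ℍ → ℍ → Set ℓ
  UnitApart p q = dist² p q ≈ 1#

  -- N ν = 1 and N (ν - 1) = 1, the latter in the equivalent form 2 re ν = 1.
  UnitFrom0And1 : ℍ → Set ℓ
  UnitFrom0And1 ν = N ν ≈ 1# × re ν + re ν ≈ 1#

  module _ {l₁ l₂} (l₁l₂-unit : UnitApart l₁ l₂) where

    -- An isometry taking l₁ to 0 and l₂ to 1.
    standardise : ℍ → ℍ
    standardise l = (l₁ -ℍ l) *ℍ conj (l₁ -ℍ l₂)

    standardise-unitApart : ∀ {l l′} → UnitApart l l′ → UnitApart (standardise l) (standardise l′)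
    standardise-unitApart {l} {l′} ll′-unit = begin
      N (standardise l -ℍ standardise l′)        ≈⟨ N-*-conj-diff (l₁ -ℍ l) (l₁ -ℍ l′) (l₁ -ℍ l₂) ⟩
      N ((l₁ -ℍ l) -ℍ (l₁ -ℍ l′)) * dist² l₁ l₂  ≈⟨ *-cong (trans (N-diff-diff l₁ l l′) ll′-unit) l₁l₂-unit ⟩
      1# * 1#                                    ≈⟨ *-identityˡ 1# ⟩
      1#                                         ∎

    standardise-unitFrom0And1 : ∀ {l} → UnitApart l₁ l → UnitApart l₂ l → UnitFrom0And1 (standardise l)
    standardise-unitFrom0And1 {l} l₁l-unit l₂l-unit = N≈1 , 2re≈1
      where
      N≈1 : N (standardise l) ≈ 1#
      N≈1 = begin
        N (standardise l)         ≈⟨ N-*-conj (l₁ -ℍ l) (l₁ -ℍ l₂) ⟩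
        dist² l₁ l * dist² l₁ l₂  ≈⟨ *-cong l₁l-unit l₁l₂-unit ⟩
        1# * 1#                   ≈⟨ *-identityˡ 1# ⟩
        1#                        ∎
      2re≈1 : re (standardise l) + re (standardise l) ≈ 1#
      2re≈1 = begin
        re (standardise l) + re (standardise l)
          ≈⟨ re-*-conj-polarisation (l₁ -ℍ l) (l₁ -ℍ l₂) ⟩
        dist² l₁ l + dist² l₁ l₂ - N ((l₁ -ℍ l₂) -ℍ (l₁ -ℍ l))
          ≈⟨ +-cong (+-cong l₁l-unit l₁l₂-unit) (-‿cong (trans (N-diff-diff l₁ l₂ l) l₂l-unit)) ⟩
        1# + 1# - 1#
          ≈⟨ //-rightDividesʳ 1# 1# ⟩
        1#
          ∎

  imDot-unitFrom0And1 : ∀ {ν} → UnitFrom0And1 ν → fromℕ 4 * imDot ν ν ≈ fromℕ 3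
  imDot-unitFrom0And1 {ν} (N≈1 , 2re≈1) = begin
    fromℕ 4 * imDot ν ν
      ≈⟨ imDot-self ν ⟩
    fromℕ 4 * N ν - (re ν + re ν) * (re ν + re ν)
      ≈⟨ +-cong (*-congˡ N≈1) (-‿cong (*-cong 2re≈1 2re≈1)) ⟩
    fromℕ 4 * 1# - 1# * 1#
      ≈⟨ solve 0 (con (+ 4) :* con (+ 1) :- con (+ 1) :* con (+ 1) := con (+ 3)) refl ⟩
    fromℕ 3
      ∎

  imDot-unitApart : ∀ {ν ν′} → UnitFrom0And1 ν → UnitFrom0And1 ν′ → UnitApart ν ν′ →
                    fromℕ 4 * imDot ν ν′ ≈ 1#
  imDot-unitApart {ν} {ν′} (N≈1 , 2re≈1) (N′≈1 , 2re′≈1) νν′-unit = begin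
    fromℕ 4 * imDot ν ν′
      ≈⟨ imDot-polarisation ν ν′ ⟩
    fromℕ 2 * (N ν + N ν′ - dist² ν ν′) - (re ν + re ν) * (re ν′ + re ν′)
      ≈⟨ +-cong (*-congˡ (+-cong (+-cong N≈1 N′≈1) (-‿cong νν′-unit))) (-‿cong (*-cong 2re≈1 2re′≈1)) ⟩
    fromℕ 2 * (1# + 1# - 1#) - 1# * 1#
      ≈⟨ solve 0 (con (+ 2) :* (con (+ 1) :+ con (+ 1) :- con (+ 1)) :- con (+ 1) :* con (+ 1) := con (+ 1)) refl ⟩
    1#
      ∎

  -- By Cauchy–Binet the doubled imaginary parts, whose Gram matrix is 2I + J, would satisfy
  -- 64 det[p,q,r] det[p,q,s] = 4 and 64 det[p,q,r]² = 64 det[p,q,s]² = 20, so 4² = 20².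
  noFourUnitFrom0And1 : ∀ {p q r s} → All UnitFrom0And1 (p ∷ q ∷ r ∷ s ∷ []) →
                        ¬ AllPairs UnitApart (p ∷ q ∷ r ∷ s ∷ [])
  noFourUnitFrom0And1 {p} {q} {r} {s} (up ∷ uq ∷ ur ∷ us ∷ [])
                      ((pq ∷ pr ∷ ps ∷ []) ∷ (qr ∷ qs ∷ []) ∷ (rs ∷ []) ∷ [] ∷ []) =
    fromℕ-suc≉0 383 (begin
      fromℕ 384
        ≈⟨ solve 0 (con (+ 384) :=
                      (con (+ 8) :* con (+ 3) :- con (+ 4)) :* (con (+ 8) :* con (+ 3) :- con (+ 4))
                      :- (con (+ 8) :* con (+ 1) :- con (+ 4)) :* (con (+ 8) :* con (+ 1) :- con (+ 4))) refl ⟩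
      (fromℕ 8 * fromℕ 3 - fromℕ 4) * (fromℕ 8 * fromℕ 3 - fromℕ 4)
        - (fromℕ 8 * 1# - fromℕ 4) * (fromℕ 8 * 1# - fromℕ 4)
        ≈⟨ +-cong (*-cong 64Dr² 64Ds²) (-‿cong (*-cong 64DrDs 64DrDs)) ⟨
      fromℕ 64 * (Dr * Dr) * (fromℕ 64 * (Ds * Ds)) - fromℕ 64 * (Dr * Ds) * (fromℕ 64 * (Dr * Ds))
        ≈⟨ solve 2 (λ u v → con (+ 64) :* (u :* u) :* (con (+ 64) :* (v :* v))
                            :- con (+ 64) :* (u :* v) :* (con (+ 64) :* (u :* v)) := con (+ 0)) refl Dr Ds ⟩
      0# ∎)
    where
    Dr Ds : Carrier
    Dr = imDet p q r
    Ds = imDet p q s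
    ⟪_,_⟫ : ℍ → ℍ → Carrier
    ⟪ x , y ⟫ = fromℕ 4 * imDot x y
    imDot-unitApartᵀ : ∀ {x y} → UnitFrom0And1 x → UnitFrom0And1 y → UnitApart x y → ⟪ y , x ⟫ ≈ 1#
    imDot-unitApartᵀ {x} {y} ux uy xy = trans (*-congˡ (imDot-comm y x)) (imDot-unitApart ux uy xy)
    gram : ∀ z w {c} → ⟪ p , w ⟫ ≈ 1# → ⟪ q , w ⟫ ≈ 1# → ⟪ z , p ⟫ ≈ 1# → ⟪ z , q ⟫ ≈ 1# → ⟪ z , w ⟫ ≈ c →
           fromℕ 64 * (imDet p q z * imDet p q w) ≈ fromℕ 8 * c - fromℕ 4
    gram z w {c} pw qw zp zq zw = begin
      fromℕ 64 * (imDet p q z * imDet p q w)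
        ≈⟨ imDet-cauchyBinet p q z w ⟩
      det₃ ⟪ p , p ⟫ ⟪ p , q ⟫ ⟪ p , w ⟫ ⟪ q , p ⟫ ⟪ q , q ⟫ ⟪ q , w ⟫ ⟪ z , p ⟫ ⟪ z , q ⟫ ⟪ z , w ⟫
        ≈⟨ det₃-cong (imDot-unitFrom0And1 up) (imDot-unitApart up uq pq) pw
                     (imDot-unitApartᵀ up uq pq) (imDot-unitFrom0And1 uq) qw zp zq zw ⟩
      det₃ (fromℕ 3) 1# 1# 1# (fromℕ 3) 1# 1# 1# c
        ≈⟨ solve 1 (λ c → det₃ᴱ (con (+ 3)) (con (+ 1)) (con (+ 1)) (con (+ 1)) (con (+ 3))
                                (con (+ 1)) (con (+ 1)) (con (+ 1)) c := con (+ 8) :* c :- con (+ 4)) refl c ⟩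
      fromℕ 8 * c - fromℕ 4 ∎
    64DrDs : fromℕ 64 * (Dr * Ds) ≈ fromℕ 8 * 1# - fromℕ 4
    64DrDs = gram r s (imDot-unitApart up us ps) (imDot-unitApart uq us qs)
      (imDot-unitApartᵀ up ur pr) (imDot-unitApartᵀ uq ur qr) (imDot-unitApart ur us rs)
    64Dr² : fromℕ 64 * (Dr * Dr) ≈ fromℕ 8 * fromℕ 3 - fromℕ 4
    64Dr² = gram r r (imDot-unitApart up ur pr) (imDot-unitApart uq ur qr)
      (imDot-unitApartᵀ up ur pr) (imDot-unitApartᵀ uq ur qr) (imDot-unitFrom0And1 ur)
    64Ds² : fromℕ 64 * (Ds * Ds) ≈ fromℕ 8 * fromℕ 3 - fromℕ 4
    64Ds² = gram s s (imDot-unitApart up us ps) (imDot-unitApart uq us qs)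
      (imDot-unitApartᵀ up us ps) (imDot-unitApartᵀ uq us qs) (imDot-unitFrom0And1 us)

  noSixUnitApart : ∀ {l₁ l₂ l₃ l₄ l₅ l₆} → ¬ AllPairs UnitApart (l₁ ∷ l₂ ∷ l₃ ∷ l₄ ∷ l₅ ∷ l₆ ∷ [])
  noSixUnitApart ((l₁l₂-unit ∷ l₁-unit) ∷ l₂-unit ∷ unit) = noFourUnitFrom0And1
    (All.map⁺ (All.zipWith (uncurry (standardise-unitFrom0And1 l₁l₂-unit)) (l₁-unit , l₂-unit)))
    (AllPairs.map⁺ (AllPairs.map (standardise-unitApart l₁l₂-unit) unit))

  unitApart-length≤5 : ∀ {ls} → AllPairs UnitApart ls → length ls ℕ.≤ 5
  unitApart-length≤5 {_ ∷ _ ∷ _ ∷ _ ∷ _ ∷ _ ∷ _} unit = ⊥-elim (noSixUnitApart (AllPairs.take⁺ 6 unit))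
  unitApart-length≤5 {[]}                    _ = z≤n
  unitApart-length≤5 {_ ∷ []}                _ = s≤s z≤n
  unitApart-length≤5 {_ ∷ _ ∷ []}            _ = s≤s (s≤s z≤n)
  unitApart-length≤5 {_ ∷ _ ∷ _ ∷ []}        _ = s≤s (s≤s (s≤s z≤n))
  unitApart-length≤5 {_ ∷ _ ∷ _ ∷ _ ∷ []}    _ = s≤s (s≤s (s≤s (s≤s z≤n)))
  unitApart-length≤5 {_ ∷ _ ∷ _ ∷ _ ∷ _ ∷ []} _ = s≤s (s≤s (s≤s (s≤s (s≤s z≤n))))

module GridLine {c ℓ} (R : RealField c ℓ) where
  open RealField R renaming (_≤_ to infix 4 _≤_)
  open Quaternions R renaming (_+ℍ_ to infixl 6 _+ℍ_; _*ℍ_ to infixl 7 _*ℍ_; _≈ℍ_ to infix 4 _≈ℍ_)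
  open OrderedFieldProperties R
  open QuaternionAlgebra R
  open UnitDistanceSets R
  open ExtremalPairs ℍ-setoid totalOrder using (ClosestPair; FarthestPair; closestPair; farthestPair)
  private module ≤ = TotalOrder totalOrder
  private module ≈ℍ = Setoid ℍ-setoid
  open import Relation.Binary.Reasoning.Setoid setoid

  module _ {A B : List ℍ} (closest : ClosestPair dist² dist²-cong A) (farthest : FarthestPair dist² dist²-cong B)
           {b b′} (b∈B : b ∈ℍ B) (b′∈B : b′ ∈ℍ B) (b≉b′ : ¬ b ≈ℍ b′) where
    open ClosestPair closest renaming (x to a₁; y to a₂; x∈xs to a₁∈A; y∈xs to a₂∈A; x≉y to a₁≉a₂)
    open FarthestPair farthest renaming (x to b₁; y to b₂; x∈xs to b₁∈B; y∈xs to b₂∈B)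

    δ D : Carrier
    δ = dist² a₁ a₂
    D = dist² b₁ b₂

    δ≉0 : ¬ δ ≈ 0#
    δ≉0 δ≈0 = dist²≈0⇒¬¬≈ δ≈0 a₁≉a₂

    D≉0 : ¬ D ≈ 0#
    D≉0 D≈0 = dist²≈0⇒¬¬≈ (≤.antisym (≤.≤-respʳ-≈ D≈0 (maximal b∈B b′∈B)) (N-nonneg (b -ℍ b′))) b≉b′

    L : Line
    L = line (a₂ , b₂) (a₁ -ℍ a₂ , b₁ -ℍ b₂) (λ (a₁-a₂≈0 , _) → a₁≉a₂ (-ℍ≈0⇒≈ a₁-a₂≈0))

    param : ∀ {s} → InGridLine A B L s → ℍ
    param (_ , _ , l , _) = l

    param-unitApart : ∀ {s s′} (g : InGridLine A B L s) (g′ : InGridLine A B L s′) →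
                      ¬ s ≈² s′ → ¬ ¬ UnitApart (param g) (param g′)
    param-unitApart {x , y} {x′ , y′} (x∈A , y∈B , l , x≈ , y≈) (x′∈A , y′∈B , l′ , x′≈ , y′≈) s≉s′ ll′≉1 =
      ¬¬-excluded-middle λ where
        (yes x≈x′) → dist²≈0⇒¬¬≈ (yy′≈0 x≈x′) (λ y≈y′ → s≉s′ (x≈x′ , y≈y′))
        (no x≉x′)  → ll′≉1 (≤.antisym t≤1 (1≤t x≉x′))
      where
      t : Carrier
      t = dist² l l′
      xx′≈tδ : dist² x x′ ≈ t * δ
      xx′≈tδ = dist²-onLine x≈ x′≈
      yy′≈tD : dist² y y′ ≈ t * D
      yy′≈tD = dist²-onLine y≈ y′≈
      t≤1 : t ≤ 1#
      t≤1 = *-cancelʳ-≤-pos (N-nonneg _) D≉0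
        (≤.≤-respʳ-≈ (sym (*-identityˡ D)) (≤.≤-respˡ-≈ yy′≈tD (maximal y∈B y′∈B)))
      1≤t : ¬ x ≈ℍ x′ → 1# ≤ t
      1≤t x≉x′ = *-cancelʳ-≤-pos (N-nonneg _) δ≉0
        (≤.≤-respˡ-≈ (sym (*-identityˡ δ)) (≤.≤-respʳ-≈ xx′≈tδ (minimal x∈A x′∈A x≉x′)))
      yy′≈0 : x ≈ℍ x′ → dist² y y′ ≈ 0#
      yy′≈0 x≈x′ = begin
        dist² y y′  ≈⟨ yy′≈tD ⟩
        t * D       ≈⟨ *-congʳ (x*y≈0⇒x≈0 δ≉0 (trans (sym xx′≈tδ) (≈⇒dist²≈0 x≈x′))) ⟩
        0# * D      ≈⟨ zeroˡ D ⟩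
        0#          ∎

    atMostFive : ∀ S → UniqueS.Unique ℍ²-setoid S → All (InGridLine A B L) S → length S ℕ.≤ 5
    atMostFive S uS gS = decidable-stable (length S ℕ.≤? 5) (¬¬-map
      (λ unit → ≡.subst (ℕ._≤ 5) (length-reduce param gS) (unitApart-length≤5 unit))
      (¬¬-allPairs (allPairs-reduce param param-unitApart uS gS)))

    twoToFive : TwoToFive A B L
    twoToFive =
      ( (a₂ , b₂) , (a₁ , b₁)
      , (a₂∈A , b₂∈B , 0ℍ , line-at-0 a₂ (a₁ -ℍ a₂) , line-at-0 b₂ (b₁ -ℍ b₂))
      , (a₁∈A , b₁∈B , 1ℍ , line-at-1 a₁ a₂ , line-at-1 b₁ b₂)
      , λ (a₂≈a₁ , _) → a₁≉a₂ (≈ℍ.sym a₂≈a₁) )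
      , atMostFive

  gridLine : ∀ {a a′ as b b′ bs} → UniqueℍList (a ∷ a′ ∷ as) → UniqueℍList (b ∷ b′ ∷ bs) →
             ∃ λ L → TwoToFive (a ∷ a′ ∷ as) (b ∷ b′ ∷ bs) L
  gridLine {a} {a′} {as} {b} {b′} {bs} uA ((b≉b′ ∷ _) ∷ _) =
    L closest farthest b∈B b′∈B b≉b′ , twoToFive closest farthest b∈B b′∈B b≉b′
    where
    closest : ClosestPair dist² dist²-cong (a ∷ a′ ∷ as)
    closest = closestPair dist² dist²-cong uA
    farthest : FarthestPair dist² dist²-cong (b ∷ b′ ∷ bs)
    farthest = farthestPair dist² dist²-cong
    b∈B : b ∈ℍ (b ∷ b′ ∷ bs)
    b∈B = here ≈ℍ.refl
    b′∈B : b′ ∈ℍ (b ∷ b′ ∷ bs)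
    b′∈B = there (here ≈ℍ.refl)

open import Data.Nat using (_≤_)

theorem4 : ∀ {c ℓ : Level} (R : RealField c ℓ) →
    (A B : List (Quaternions.ℍ R)) →
    Quaternions.UniqueℍList R A → Quaternions.UniqueℍList R B →
    2 ≤ length A → 2 ≤ length B →
    ∃ λ (L : Quaternions.Line R) → Quaternions.TwoToFive R A B L
theorem4 R (_ ∷ _ ∷ _) (_ ∷ _ ∷ _) uA uB (s≤s (s≤s _)) (s≤s (s≤s _)) = GridLine.gridLine R uA uB
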